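{- Let $G$ be a connected graph on $n$ vertices with $\mathrm{diam}(G)\le 2$. Then for every positive integer $k$, $\pi_k(G)\le n+7k-6$.
   Context: A configuration on a graph $G$ is a function $C:V(G)\to\mathbb{Z}_{\ge 0}$ (number of pebbles on each vertex), of size $|C|=\sum_v C(v)$. A pebbling move takes two pebbles off a vertex and places one pebble on a neighboring vertex. For a root vertex $r$, a configuration is $k$-fold $r$-solvable if some sequence of pebbling moves results in at least $k$ pebbles on $r$. $\pi_k(G,r)$ is the smallest positive integer $m$ such that every configuration of size $m$ is $k$-fold $r$-solvable, and the $k$-pebbling number is $\pi_k(G)=\max_{r\in V(G)}\pi_k(G,r)$. -}

module Defs where

open import Data.Nat using (ℕ; _+_; _∸_; _≤_)
open import Data.Fin using (Fin)
open import Data.Fin.Properties using (_≟_)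
open import Data.List using (map; allFin)
open import Data.Nat.ListAction using (sum)
open import Data.Product using (Σ; ∃; ∃-syntax; _×_; _,_)
open import Data.Sum using (_⊎_)
open import Relation.Nullary using (¬_; yes; no)
open import Relation.Binary.PropositionalEquality using (_≡_)
open import Relation.Binary.Construct.Closure.ReflexiveTransitive using (Star)

record Graph (n : ℕ) : Set₁ where
  field
    Adj     : Fin n → Fin n → Set
    symm    : ∀ {u v} → Adj u v → Adj v u
    irrefl  : ∀ {u} → ¬ Adj u u
open Graph public

Connected : ∀ {n} → Graph n → Set
Connected G = ∀ u v → Star (Adj G) u v

DistLe2 : ∀ {n} → Graph n → Fin n → Fin n → Set
DistLe2 G u v = u ≡ v ⊎ Adj G u v ⊎ (∃[ w ] (Adj G u w × Adj G w v))

DiamLe2 : ∀ {n} → Graph n → Set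
DiamLe2 G = ∀ u v → DistLe2 G u v

Config : ℕ → Set
Config n = Fin n → ℕ

size : ∀ {n} → Config n → ℕ
size {n} C = sum (map C (allFin n))

move : ∀ {n} → Config n → Fin n → Fin n → Config n
move C u v w with w ≟ u | w ≟ v
... | yes _ | _     = C u ∸ 2
... | no _  | yes _ = C v + 1
... | no _  | no _  = C w

Step : ∀ {n} → Graph n → Config n → Config n → Set
Step G C D = ∃[ u ] ∃[ v ] (Adj G u v × 2 ≤ C u × D ≡ move C u v)

Solvable : ∀ {n} → Graph n → ℕ → Fin n → Config n → Set
Solvable G k r C = ∃[ D ] (Star (Step G) C D × k ≤ D r)

-- π_k(G,r) ≤ N : some positive m ≤ N has every configuration of size m k-fold r-solvable
-- (π_k(G,r) is the least such positive m, so this is exactly π_k(G,r) ≤ N).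
PiLe : ∀ {n} → Graph n → ℕ → Fin n → ℕ → Set
PiLe {n} G k r N = ∃[ m ] (1 ≤ m × m ≤ N × (∀ (C : Config n) → size C ≡ m → Solvable G k r C))

-- π_k(G) ≤ N : π_k(G,r) ≤ N for every root r (π_k(G) is the max over r).
PiGraphLe : ∀ {n} → Graph n → ℕ → ℕ → Set
PiGraphLe G k N = ∀ r → PiLe G k r N

module Submission where

-- Write c for the number of pebbles on the root r. The key lemma: if the configuration has
-- more than c + n pebbles, then some sequence of moves brings one more pebble to r while
-- losing at most 6 pebbles. Hence |C| + 6c never decreases, and when it is at least
-- n + 7k − 6 (as it is initially) it forces |C| > c + n as long as c < k.
--
-- The key lemma is a pigeonhole argument. Fix a vertex M ≠ r holding three pebbles, if
-- there is one. On each vertex v ≠ r, the first pebble claims v, the second the middle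
-- vertex of a path v – y – r, and the third the middle vertex of a path v – y – M (or r
-- itself when v = M). A fourth pebble on v, a pebble with nothing to claim (v adjacent to
-- r or to M), or two claims on the same vertex each yield such a gain by an explicit
-- short sequence of moves, using diam(G) ≤ 2. Otherwise distinct pebbles claim distinct
-- vertices, so at most n pebbles lie off the root.

open import Defs
open import Data.Empty using (⊥-elim)
open import Data.Fin using (Fin; zero; suc; toℕ)
open import Data.Fin.Properties using (_≟_; any?; suc-injective; toℕ-injective; toℕ<n; ¬Fin0)
open import Data.List using (map; tabulate)
open import Data.Nat using (ℕ; zero; suc; _+_; _*_; _∸_; _≤_; _<_; z≤n; s≤s; _≤?_)
open import Data.Nat.ListAction using (sum)
open import Data.Nat.Properties hiding (_≟_; suc-injective)
open import Algebra.Properties.Semiring.Sum +-*-semiring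
  using (sum-syntax; sum-cong-≗; sum-replicate-zero; ∑-distrib-+; ∑-comm; *-distribˡ-sum)
open import Data.Nat.Solver using (module +-*-Solver)
open import Data.Product using (∃-syntax; _×_; _,_; proj₁; proj₂)
open import Data.Sum using (_⊎_; inj₁; inj₂)
open import Function using (_∘_; id)
open import Relation.Binary.Construct.Closure.ReflexiveTransitive using (Star; ε; _◅_; _◅◅_)
open import Relation.Binary.PropositionalEquality
open import Relation.Nullary using (Dec; yes; no; ¬?; _×-dec_)
open +-*-Solver using (solve; _:+_; _:*_; _:=_; con)

variable
  m n : ℕ

𝟙 : ∀ {p} {P : Set p} → Dec P → ℕ
𝟙 (yes _) = 1
𝟙 (no _)  = 0

δ : Fin n → Fin n → ℕ
δ x y = 𝟙 (x ≟ y)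

δ-refl : ∀ (x : Fin n) → δ x x ≡ 1
δ-refl x with x ≟ x
... | yes _  = refl
... | no x≢x = ⊥-elim (x≢x refl)

δ-≢ : ∀ {x y : Fin n} → x ≢ y → δ x y ≡ 0
δ-≢ {x = x} {y} x≢y with x ≟ y
... | yes x≡y = ⊥-elim (x≢y x≡y)
... | no _    = refl

δ-≤1 : ∀ (x y : Fin n) → δ x y ≤ 1
δ-≤1 x y with x ≟ y
... | yes _ = ≤-refl
... | no _  = z≤n

δ-pos : ∀ {x y : Fin n} → 1 ≤ δ x y → x ≡ y
δ-pos {x = x} {y} pos with x ≟ y
... | yes x≡y = x≡y
δ-pos () | no _

sum-map-tabulate : ∀ (f : Fin m → ℕ) (g : Fin n → Fin m) → sum (map f (tabulate g)) ≡ ∑[ i < n ] f (g i)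
sum-map-tabulate {n = zero}  f g = refl
sum-map-tabulate {n = suc n} f g = cong (f (g zero) +_) (sum-map-tabulate f (g ∘ suc))

size≡∑ : ∀ (C : Config n) → size C ≡ ∑[ v < n ] C v
size≡∑ C = sum-map-tabulate C id

∑-mono-≤ : ∀ {f g : Fin n → ℕ} → (∀ i → f i ≤ g i) → ∑[ i < n ] f i ≤ ∑[ i < n ] g i
∑-mono-≤ {zero}  f≤g = z≤n
∑-mono-≤ {suc n} f≤g = +-mono-≤ (f≤g zero) (∑-mono-≤ (f≤g ∘ suc))

∑-ones : ∀ n → ∑[ i < n ] 1 ≡ n
∑-ones zero    = refl
∑-ones (suc n) = cong suc (∑-ones n)

∑-single : ∀ {f : Fin n → ℕ} x → (∀ i → i ≢ x → f i ≡ 0) → ∑[ i < n ] f i ≡ f x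
∑-single {suc n} {f} zero    f≡0 =
  trans (cong (f zero +_) (trans (sum-cong-≗ (λ i → f≡0 (suc i) λ ())) (sum-replicate-zero n)))
        (+-identityʳ (f zero))
∑-single {suc n} {f} (suc x) f≡0 =
  cong₂ _+_ (f≡0 zero λ ()) (∑-single x (λ i i≢x → f≡0 (suc i) (i≢x ∘ suc-injective)))

∑-δˡ : ∀ (x : Fin n) → ∑[ y < n ] δ x y ≡ 1
∑-δˡ x = trans (∑-single x (λ y y≢x → δ-≢ (y≢x ∘ sym))) (δ-refl x)

∑-δʳ : ∀ (y : Fin n) → ∑[ x < n ] δ x y ≡ 1
∑-δʳ y = trans (∑-single y (λ x → δ-≢)) (δ-refl y)

∑-positive : ∀ (f : Fin n → ℕ) → 1 ≤ ∑[ i < n ] f i → ∃[ i ] 1 ≤ f i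
∑-positive {suc n} f pos with f zero in eq
... | suc _ = zero , subst (1 ≤_) (sym eq) (s≤s z≤n)
... | zero  = let i , pᵢ = ∑-positive (f ∘ suc) pos in suc i , pᵢ

∑-two : ∀ (f : Fin n → ℕ) → 2 ≤ ∑[ i < n ] f i →
        (∃[ i ] 2 ≤ f i) ⊎ (∃[ i ] ∃[ j ] i ≢ j × 1 ≤ f i × 1 ≤ f j)
∑-two {suc n} f 2≤∑ with f zero in eq
... | suc (suc _) = inj₁ (zero , subst (2 ≤_) (sym eq) (s≤s (s≤s z≤n)))
... | suc zero    = let j , pⱼ = ∑-positive (f ∘ suc) (≤-pred 2≤∑) in
                    inj₂ (zero , suc j , (λ ()) , subst (1 ≤_) (sym eq) ≤-refl , pⱼ)
... | zero with ∑-two (f ∘ suc) 2≤∑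
...   | inj₁ (i , pᵢ)              = inj₁ (suc i , pᵢ)
...   | inj₂ (i , j , i≢j , pᵢ , pⱼ) = inj₂ (suc i , suc j , i≢j ∘ suc-injective , pᵢ , pⱼ)

∑-fibres : ∀ (k : Fin m → ℕ) (f : ∀ x → Fin (k x) → Fin n) →
           ∑[ x < m ] k x ≡ ∑[ y < n ] ∑[ x < m ] ∑[ i < k x ] δ (f x i) y
∑-fibres {m} {n} k f = begin
  ∑[ x < m ] k x                                     ≡⟨ sum-cong-≗ (λ x → sym (∑-ones (k x))) ⟩
  ∑[ x < m ] ∑[ i < k x ] 1                          ≡⟨ sum-cong-≗ (λ x → sum-cong-≗ (λ i → sym (∑-δˡ (f x i)))) ⟩
  ∑[ x < m ] ∑[ i < k x ] ∑[ y < n ] δ (f x i) y     ≡⟨ sum-cong-≗ (λ x → ∑-comm (λ i y → δ (f x i) y)) ⟩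
  ∑[ x < m ] ∑[ y < n ] ∑[ i < k x ] δ (f x i) y     ≡⟨ ∑-comm (λ x y → ∑[ i < k x ] δ (f x i) y) ⟩
  ∑[ y < n ] ∑[ x < m ] ∑[ i < k x ] δ (f x i) y     ∎
  where open ≡-Reasoning

pigeonhole-∑ : ∀ (k : Fin m → ℕ) (f : ∀ x → Fin (k x) → Fin n) →
               (∀ y → ∑[ x < m ] ∑[ i < k x ] δ (f x i) y ≤ 1) → ∑[ x < m ] k x ≤ n
pigeonhole-∑ {m} {n} k f fibre≤1 = begin
  ∑[ x < m ] k x                                  ≡⟨ ∑-fibres k f ⟩
  ∑[ y < n ] ∑[ x < m ] ∑[ i < k x ] δ (f x i) y  ≤⟨ ∑-mono-≤ fibre≤1 ⟩
  ∑[ y < n ] 1                                    ≡⟨ ∑-ones n ⟩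
  n                                               ∎
  where open ≤-Reasoning

∀-⊎ : ∀ {P : Fin n → Set} {S : Set} → (∀ i → P i ⊎ S) → (∀ i → P i) ⊎ S
∀-⊎ {zero}  h = inj₁ λ ()
∀-⊎ {suc n} h with h zero | ∀-⊎ (h ∘ suc)
... | inj₂ s  | _       = inj₂ s
... | inj₁ _  | inj₂ s  = inj₂ s
... | inj₁ p₀ | inj₁ ps = inj₁ λ { zero → p₀ ; (suc i) → ps i }

_without_ : Config n → Fin n → Config n
(C without r) v with v ≟ r
... | yes _ = 0
... | no _  = C v

without-self : ∀ (C : Config n) r → (C without r) r ≡ 0
without-self C r with r ≟ r
... | yes _  = refl
... | no r≢r = ⊥-elim (r≢r refl)

without-≢ : ∀ (C : Config n) {r v} → Fin ((C without r) v) → v ≢ r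
without-≢ C {r} i refl = ¬Fin0 (subst Fin (without-self C r) i)

without-≤ : ∀ (C : Config n) r v → (C without r) v ≤ C v
without-≤ C r v with v ≟ r
... | yes _ = z≤n
... | no _  = ≤-refl

without-split : ∀ (C : Config n) r v → C v ≡ δ v r * C r + (C without r) v
without-split C r v with v ≟ r
... | yes v≡r = trans (cong C v≡r) (sym (trans (+-identityʳ (1 * C r)) (*-identityˡ (C r))))
... | no _    = refl

∑-without : ∀ (C : Config n) r → ∑[ v < n ] C v ≡ C r + ∑[ v < n ] (C without r) v
∑-without {n} C r = begin
  ∑[ v < n ] C v                                      ≡⟨ sum-cong-≗ (without-split C r) ⟩
  ∑[ v < n ] (δ v r * C r + (C without r) v)          ≡⟨ ∑-distrib-+ (λ v → δ v r * C r) (C without r) ⟩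
  ∑[ v < n ] (δ v r * C r) + ∑[ v < n ] (C without r) v ≡⟨ cong (_+ ∑[ v < n ] (C without r) v) at-root ⟩
  C r + ∑[ v < n ] (C without r) v                    ∎
  where
  open ≡-Reasoning
  at-root : ∑[ v < n ] (δ v r * C r) ≡ C r
  at-root = trans (∑-single r (λ v v≢r → cong (_* C r) (δ-≢ v≢r)))
                  (trans (cong (_* C r) (δ-refl r)) (*-identityˡ (C r)))

module _ (C : Config n) where

  move-source : ∀ u v → move C u v u ≡ C u ∸ 2
  move-source u v with u ≟ u
  ... | yes _  = refl
  ... | no u≢u = ⊥-elim (u≢u refl)

  move-target : ∀ {u v} → u ≢ v → move C u v v ≡ suc (C v)
  move-target {u} {v} u≢v with v ≟ u | v ≟ v
  ... | yes v≡u | _      = ⊥-elim (u≢v (sym v≡u))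
  ... | no _    | yes _  = +-comm (C v) 1
  ... | no _    | no v≢v = ⊥-elim (v≢v refl)

  move-raises : ∀ {u v k} → u ≢ v → k ≤ C v → suc k ≤ move C u v v
  move-raises u≢v k≤Cv = ≤-trans (s≤s k≤Cv) (≤-reflexive (sym (move-target u≢v)))

  move-keeps : ∀ {u v w k} → w ≢ u → k ≤ C w → k ≤ move C u v w
  move-keeps {u} {v} {w} w≢u k≤Cw with w ≟ u | w ≟ v
  ... | yes w≡u | _        = ⊥-elim (w≢u w≡u)
  ... | no _    | yes refl = ≤-trans k≤Cw (m≤m+n (C w) 1)
  ... | no _    | no _     = k≤Cw

  -- Stated with both sides shifted so that no truncated subtraction occurs.
  move-balance : ∀ {u v} → u ≢ v → 2 ≤ C u → ∀ w → move C u v w + 2 * δ w u ≡ C w + δ w v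
  move-balance {u} {v} u≢v 2≤Cu w with w ≟ u | w ≟ v
  ... | yes refl | yes refl = ⊥-elim (u≢v refl)
  ... | yes refl | no _     = trans (m∸n+n≡m 2≤Cu) (sym (+-identityʳ (C w)))
  ... | no _     | yes refl = +-identityʳ (C w + 1)
  ... | no _     | no _     = refl

  size-move : ∀ {u v} → u ≢ v → 2 ≤ C u → size C ≡ suc (size (move C u v))
  size-move {u} {v} u≢v 2≤Cu = +-cancelʳ-≡ 1 _ _ (begin
    size C + 1                                        ≡⟨ cong₂ _+_ (size≡∑ C) (sym (∑-δʳ v)) ⟩
    ∑[ w < n ] C w + ∑[ w < n ] δ w v                 ≡⟨ sym (∑-distrib-+ C (λ w → δ w v)) ⟩
    ∑[ w < n ] (C w + δ w v)                          ≡⟨ sym (sum-cong-≗ (move-balance u≢v 2≤Cu)) ⟩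
    ∑[ w < n ] (move C u v w + 2 * δ w u)             ≡⟨ ∑-distrib-+ (move C u v) (λ w → 2 * δ w u) ⟩
    ∑[ w < n ] move C u v w + ∑[ w < n ] (2 * δ w u)    ≡⟨ cong₂ _+_ (sym (size≡∑ (move C u v))) two-pebbles ⟩
    size (move C u v) + 2                             ≡⟨ +-suc (size (move C u v)) 1 ⟩
    suc (size (move C u v)) + 1                       ∎)
    where
    open ≡-Reasoning
    two-pebbles : ∑[ w < n ] (2 * δ w u) ≡ 2
    two-pebbles = trans (sym (*-distribˡ-sum 2 (λ w → δ w u))) (cong (2 *_) (∑-δʳ u))

module Gains {n} (G : Graph n) (r : Fin n) where

  adjacent⇒≢ : ∀ {u v} → Adj G u v → u ≢ v
  adjacent⇒≢ u~u refl = irrefl G u~u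

  record Gain (s : ℕ) (C : Config n) : Set where
    constructor gain
    field
      after      : Config n
      moves      : Star (Step G) C after
      root-grows : C r < after r
      cost       : size C ≤ size after + s

  relax : ∀ {s t C} → Gain s C → Gain (s + t) C
  relax {s} {t} (gain D moves grows cost) = gain D moves grows (≤-trans cost (+-monoʳ-≤ (size D) (m≤m+n s t)))

  gain-adjacent : ∀ {C u} → Adj G u r → 2 ≤ C u → Gain 1 C
  gain-adjacent {C} {u} u~r 2≤Cu =
    gain (move C u r) ((u , r , u~r , 2≤Cu , refl) ◅ ε) (move-raises C (adjacent⇒≢ u~r) ≤-refl)
         (≤-reflexive (trans (size-move C (adjacent⇒≢ u~r) 2≤Cu) (+-comm 1 _)))

  gain-after-move : ∀ {s C u v} → u ≢ r → Adj G u v → 2 ≤ C u → Gain s (move C u v) → Gain (suc s) C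
  gain-after-move {s} {C} {u} {v} u≢r u~v 2≤Cu (gain D moves grows cost) =
    gain D ((u , v , u~v , 2≤Cu , refl) ◅ moves) (≤-trans (s≤s (move-keeps C (u≢r ∘ sym) ≤-refl)) grows)
      (begin
        size C                  ≡⟨ size-move C (adjacent⇒≢ u~v) 2≤Cu ⟩
        suc (size (move C u v)) ≤⟨ s≤s cost ⟩
        suc (size D + s)        ≡⟨ sym (+-suc (size D) s) ⟩
        size D + suc s          ∎)
    where open ≤-Reasoning

  gain-four : ∀ {C v} → v ≢ r → DistLe2 G v r → 4 ≤ C v → Gain 3 C
  gain-four v≢r (inj₁ v≡r) _ = ⊥-elim (v≢r v≡r)
  gain-four v≢r (inj₂ (inj₁ v~r)) 4≤Cv = relax (gain-adjacent v~r (≤-trans (m≤m+n 2 2) 4≤Cv))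
  gain-four {C} {v} v≢r (inj₂ (inj₂ (w , v~w , w~r))) 4≤Cv =
    gain-after-move v≢r v~w (≤-trans (m≤m+n 2 2) 4≤Cv)
      (gain-after-move v≢r v~w (subst (2 ≤_) (sym (move-source C v w)) (∸-monoˡ-≤ 2 4≤Cv))
        (gain-adjacent w~r (move-raises (move C v w) v≢w (move-raises C v≢w z≤n))))
    where v≢w = adjacent⇒≢ v~w

  gain-relay : ∀ {C v w} → v ≢ r → Adj G v w → Adj G w r → 2 ≤ C v → 1 ≤ C w → Gain 2 C
  gain-relay {C} v≢r v~w w~r 2≤Cv 1≤Cw =
    gain-after-move v≢r v~w 2≤Cv (gain-adjacent w~r (move-raises C (adjacent⇒≢ v~w) 1≤Cw))

  gain-merge : ∀ {C u v y} → u ≢ v → u ≢ r → v ≢ r → Adj G u y → Adj G v y → Adj G y r →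
               2 ≤ C u → 2 ≤ C v → Gain 3 C
  gain-merge {C} {u} {v} {y} u≢v u≢r v≢r u~y v~y y~r 2≤Cu 2≤Cv =
    gain-after-move u≢r u~y 2≤Cu
      (gain-after-move v≢r v~y (move-keeps C (u≢v ∘ sym) 2≤Cv)
        (gain-adjacent y~r (move-raises (move C u y) (adjacent⇒≢ v~y) (move-raises C (adjacent⇒≢ u~y) z≤n))))

  gain-feed : ∀ {C u v} → u ≢ r → v ≢ r → Adj G u v → DistLe2 G v r → 2 ≤ C u → 3 ≤ C v → Gain 4 C
  gain-feed {C} u≢r v≢r u~v v-r 2≤Cu 3≤Cv =
    gain-after-move u≢r u~v 2≤Cu (gain-four v≢r v-r (move-raises C (adjacent⇒≢ u~v) 3≤Cv))

  gain-relay-feed : ∀ {C u y v} → u ≢ v → u ≢ r → y ≢ r → v ≢ r → Adj G u y → Adj G y v → DistLe2 G v r →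
                    2 ≤ C u → 1 ≤ C y → 3 ≤ C v → Gain 5 C
  gain-relay-feed {C} {u} {y} u≢v u≢r y≢r v≢r u~y y~v v-r 2≤Cu 1≤Cy 3≤Cv =
    gain-after-move u≢r u~y 2≤Cu
      (gain-feed y≢r v≢r y~v v-r (move-raises C (adjacent⇒≢ u~y) 1≤Cy) (move-keeps C (u≢v ∘ sym) 3≤Cv))

  gain-merge-feed : ∀ {C u v y z} → u ≢ v → u ≢ z → v ≢ z → u ≢ r → v ≢ r → y ≢ r → z ≢ r →
                    Adj G u y → Adj G v y → Adj G y z → DistLe2 G z r →
                    2 ≤ C u → 2 ≤ C v → 3 ≤ C z → Gain 6 C
  gain-merge-feed {C} {u} {v} {y} {z} u≢v u≢z v≢z u≢r v≢r y≢r z≢r u~y v~y y~z z-r 2≤Cu 2≤Cv 3≤Cz =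
    gain-after-move u≢r u~y 2≤Cu
      (gain-after-move v≢r v~y (move-keeps C (u≢v ∘ sym) 2≤Cv)
        (gain-feed y≢r z≢r y~z z-r (move-raises C₁ (adjacent⇒≢ v~y) (move-raises C (adjacent⇒≢ u~y) z≤n))
          (move-keeps C₁ (v≢z ∘ sym) (move-keeps C (u≢z ∘ sym) 3≤Cz))))
    where C₁ = move C u y

module Claims {n} (G : Graph n) (W : DiamLe2 G) (r : Fin n) (C : Config n) (M : Fin n)
              (hub : ∀ {v} → v ≢ r → 3 ≤ C v → M ≢ r × 3 ≤ C M) where
  open Gains G r

  3≤⇒2≤ : ∀ {c} → 3 ≤ c → 2 ≤ c
  3≤⇒2≤ = ≤-trans (n≤1+n 2)

  -- The junk value u (when d is not a path of length two) is never claimed: those cases are gains.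
  middle : ∀ {u w} → DistLe2 G u w → Fin n
  middle (inj₂ (inj₂ (x , _))) = x
  middle {u} _                 = u

  hub-target : ∀ {v} → Dec (v ≡ M) → Fin n
  hub-target (yes _)    = r
  hub-target {v} (no _) = middle (W v M)

  target : Fin n → ℕ → Fin n
  target v 0                   = v
  target v 1                   = middle (W v r)
  target v 2                   = hub-target (v ≟ M)
  target v (suc (suc (suc _))) = v   -- a fourth pebble is a gain outright

  data Claim : Fin n → ℕ → Fin n → Set where
    own     : ∀ {v} → 1 ≤ C v → Claim v 0 v
    viaRoot : ∀ {v y} → 2 ≤ C v → Adj G v y → Adj G y r → Claim v 1 y
    atHub   : 3 ≤ C M → Claim M 2 r
    viaHub  : ∀ {v y} → 3 ≤ C v → v ≢ M → Adj G v y → Adj G y M → Claim v 2 y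

  toward-root : ∀ {v} → v ≢ r → 2 ≤ C v → (d : DistLe2 G v r) → Claim v 1 (middle d) ⊎ Gain 6 C
  toward-root v≢r _    (inj₁ v≡r)                    = ⊥-elim (v≢r v≡r)
  toward-root v≢r 2≤Cv (inj₂ (inj₁ v~r))             = inj₂ (relax (gain-adjacent v~r 2≤Cv))
  toward-root v≢r 2≤Cv (inj₂ (inj₂ (_ , v~y , y~r))) = inj₁ (viaRoot 2≤Cv v~y y~r)

  toward-hub : ∀ {v} → v ≢ r → 3 ≤ C v → (d : Dec (v ≡ M)) → Claim v 2 (hub-target d) ⊎ Gain 6 C
  toward-hub         v≢r 3≤Cv (yes refl) = inj₁ (atHub 3≤Cv)
  toward-hub {v} v≢r 3≤Cv (no v≢M)   = via (W v M)
    where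
    via : (d : DistLe2 G v M) → Claim v 2 (middle d) ⊎ Gain 6 C
    via (inj₁ v≡M)                   = ⊥-elim (v≢M v≡M)
    via (inj₂ (inj₁ v~M))            = let M≢r , 3≤CM = hub v≢r 3≤Cv in
                                       inj₂ (relax (gain-feed v≢r M≢r v~M (W M r) (3≤⇒2≤ 3≤Cv) 3≤CM))
    via (inj₂ (inj₂ (_ , v~y , y~M))) = inj₁ (viaHub 3≤Cv v≢M v~y y~M)

  claim : ∀ {v} s → v ≢ r → s < C v → Claim v s (target v s) ⊎ Gain 6 C
  claim     0                   _   1≤Cv = inj₁ (own 1≤Cv)
  claim {v} 1                   v≢r 2≤Cv = toward-root v≢r 2≤Cv (W v r)
  claim {v} 2                   v≢r 3≤Cv = toward-hub v≢r 3≤Cv (v ≟ M)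
  claim {v} (suc (suc (suc _))) v≢r 4+≤Cv = inj₂ (relax (gain-four v≢r (W v r) (≤-trans (m≤m+n 4 _) 4+≤Cv)))

  own-viaRoot : ∀ {y v} → 1 ≤ C y → v ≢ r → 2 ≤ C v → Adj G v y → Adj G y r → Gain 6 C
  own-viaRoot 1≤Cy v≢r 2≤Cv v~y y~r = relax (gain-relay v≢r v~y y~r 2≤Cv 1≤Cy)

  own-viaHub : ∀ {y v} → y ≢ r → 1 ≤ C y → v ≢ r → 3 ≤ C v → v ≢ M → Adj G v y → Adj G y M → Gain 6 C
  own-viaHub y≢r 1≤Cy v≢r 3≤Cv v≢M v~y y~M =
    let M≢r , 3≤CM = hub v≢r 3≤Cv in
    relax (gain-relay-feed v≢M v≢r y≢r M≢r v~y y~M (W M r) (3≤⇒2≤ 3≤Cv) 1≤Cy 3≤CM)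

  viaRoot-viaHub : ∀ {y v} → Adj G y r → v ≢ r → 3 ≤ C v → v ≢ M → Adj G v y → Adj G y M → Gain 6 C
  viaRoot-viaHub y~r v≢r 3≤Cv v≢M v~y y~M =
    let M≢r , 3≤CM = hub v≢r 3≤Cv in
    relax (gain-merge v≢M v≢r M≢r v~y (symm G y~M) y~r (3≤⇒2≤ 3≤Cv) (3≤⇒2≤ 3≤CM))

  atHub-viaHub : ∀ {v} → 3 ≤ C v → Adj G v r → Gain 6 C
  atHub-viaHub 3≤Cv v~r = relax (gain-adjacent v~r (3≤⇒2≤ 3≤Cv))

  viaHub-viaHub : ∀ {y u v} → u ≢ v → u ≢ r → v ≢ r → 3 ≤ C u → 3 ≤ C v → u ≢ M → v ≢ M →
                  Adj G u y → Adj G v y → Adj G y M → Gain 6 C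
  viaHub-viaHub {y} u≢v u≢r v≢r 3≤Cu 3≤Cv u≢M v≢M u~y v~y y~M with y ≟ r
  ... | yes refl = atHub-viaHub 3≤Cu u~y
  ... | no y≢r   = let M≢r , 3≤CM = hub u≢r 3≤Cu in
                   gain-merge-feed u≢v u≢M v≢M u≢r v≢r y≢r M≢r u~y v~y y~M (W M r)
                                   (3≤⇒2≤ 3≤Cu) (3≤⇒2≤ 3≤Cv) 3≤CM

  conflict : ∀ {v v' s s' y} → v ≢ r → v' ≢ r → (v , s) ≢ (v' , s') → Claim v s y → Claim v' s' y → Gain 6 C
  conflict _   _    distinct (own _)          (own _)             = ⊥-elim (distinct refl)
  conflict _   v'≢r _        (own 1≤Cy)       (viaRoot q v~y y~r) = own-viaRoot 1≤Cy v'≢r q v~y y~r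
  conflict v≢r _    _        (own _)          (atHub _)           = ⊥-elim (v≢r refl)
  conflict v≢r v'≢r _        (own 1≤Cy)       (viaHub q ne a b)   = own-viaHub v≢r 1≤Cy v'≢r q ne a b
  conflict v≢r _    _        (viaRoot q v~y y~r) (own 1≤Cy)       = own-viaRoot 1≤Cy v≢r q v~y y~r
  conflict v≢r v'≢r distinct (viaRoot q a y~r) (viaRoot q' a' _) =
    relax (gain-merge (distinct ∘ cong (_, 1)) v≢r v'≢r a a' y~r q q')
  conflict _   _    _        (viaRoot _ _ r~r) (atHub _)          = ⊥-elim (irrefl G r~r)
  conflict _   v'≢r _        (viaRoot _ _ y~r) (viaHub q ne a b)  = viaRoot-viaHub y~r v'≢r q ne a b
  conflict _   v'≢r _        (atHub _)        (own _)             = ⊥-elim (v'≢r refl)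
  conflict _   _    _        (atHub _)        (viaRoot _ _ r~r)   = ⊥-elim (irrefl G r~r)
  conflict _   _    distinct (atHub _)        (atHub _)           = ⊥-elim (distinct refl)
  conflict _   _    _        (atHub _)        (viaHub q _ v~r _)  = atHub-viaHub q v~r
  conflict v≢r v'≢r _        (viaHub q ne a b) (own 1≤Cy)         = own-viaHub v'≢r 1≤Cy v≢r q ne a b
  conflict v≢r _    _        (viaHub q ne a b) (viaRoot _ _ y~r)  = viaRoot-viaHub y~r v≢r q ne a b
  conflict _   _    _        (viaHub q _ v~r _) (atHub _)         = atHub-viaHub q v~r
  conflict v≢r v'≢r distinct (viaHub q ne a b) (viaHub q' ne' a' _) =
    viaHub-viaHub (distinct ∘ cong (_, 2)) v≢r v'≢r q q' ne ne' a a' b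

  token-claim : ∀ v (i : Fin ((C without r) v)) → Claim v (toℕ i) (target v (toℕ i)) ⊎ Gain 6 C
  token-claim v i = claim (toℕ i) (without-≢ C i) (≤-trans (toℕ<n i) (without-≤ C r v))

  collide : ∀ {y} v (i : Fin ((C without r) v)) v' (i' : Fin ((C without r) v')) →
            (v , toℕ i) ≢ (v' , toℕ i') → target v (toℕ i) ≡ y → target v' (toℕ i') ≡ y → Gain 6 C
  collide v i v' i' distinct refl hit' with token-claim v i | token-claim v' i'
  ... | inj₂ g  | _       = g
  ... | inj₁ _  | inj₂ g  = g
  ... | inj₁ c  | inj₁ c' = conflict (without-≢ C i) (without-≢ C i') distinct c (subst (Claim v' _) hit' c')

  claimants : Fin n → ℕ
  claimants y = ∑[ v < n ] ∑[ i < (C without r) v ] δ (target v (toℕ i)) y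

  claimants-≤1 : ∀ y → claimants y ≤ 1 ⊎ Gain 6 C
  claimants-≤1 y with claimants y ≤? 1
  ... | yes ≤1 = inj₁ ≤1
  ... | no ≰1 with ∑-two _ (≰⇒> ≰1)
  ...   | inj₂ (v , v' , v≢v' , p , p') =
    let i , q = ∑-positive _ p ; i' , q' = ∑-positive _ p' in
    inj₂ (collide v i v' i' (v≢v' ∘ cong proj₁) (δ-pos q) (δ-pos q'))
  ...   | inj₁ (v , 2≤) with ∑-two _ 2≤
  ...     | inj₁ (i , 2≤δ) = ⊥-elim (≤⇒≯ (δ-≤1 _ _) 2≤δ)
  ...     | inj₂ (i , i' , i≢i' , p , p') =
    inj₂ (collide v i v i' (i≢i' ∘ toℕ-injective ∘ cong proj₂) (δ-pos p) (δ-pos p'))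

  bounded-or-gain : size C ≤ C r + n ⊎ Gain 6 C
  bounded-or-gain with ∀-⊎ claimants-≤1
  ... | inj₂ g   = inj₂ g
  ... | inj₁ ≤1  = inj₁ (begin
    size C                              ≡⟨ size≡∑ C ⟩
    ∑[ v < n ] C v                      ≡⟨ ∑-without C r ⟩
    C r + ∑[ v < n ] (C without r) v    ≤⟨ +-monoʳ-≤ (C r) (pigeonhole-∑ (C without r) (λ v i → target v (toℕ i)) ≤1) ⟩
    C r + n                             ∎)
    where open ≤-Reasoning

surplus : ∀ n {c k s} → c < k → n + 7 * k ≤ s + 6 * c + 6 → c + n < s
surplus n {c} {k} {s} c<k budget = +-cancelʳ-≤ (6 * c + 6) (suc (c + n)) s (begin
  suc (c + n) + (6 * c + 6) ≡⟨ solve 2 (λ c n → con 1 :+ (c :+ n) :+ (con 6 :* c :+ con 6)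
                                           := n :+ con 7 :* (con 1 :+ c)) refl c n ⟩
  n + 7 * suc c             ≤⟨ +-monoʳ-≤ n (*-monoʳ-≤ 7 c<k) ⟩
  n + 7 * k                 ≤⟨ budget ⟩
  s + 6 * c + 6             ≡⟨ +-assoc s (6 * c) 6 ⟩
  s + (6 * c + 6)           ∎)
  where open ≤-Reasoning

potential-mono : ∀ {s c s' c'} → c < c' → s ≤ s' + 6 → s + 6 * c ≤ s' + 6 * c'
potential-mono {s} {c} {s'} {c'} c<c' s≤ = begin
  s + 6 * c        ≤⟨ +-monoˡ-≤ (6 * c) s≤ ⟩
  s' + 6 + 6 * c   ≡⟨ +-assoc s' 6 (6 * c) ⟩
  s' + (6 + 6 * c) ≡⟨ cong (s' +_) (sym (*-suc 6 c)) ⟩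
  s' + 6 * suc c   ≤⟨ +-monoʳ-≤ s' (*-monoʳ-≤ 6 c<c') ⟩
  s' + 6 * c'      ∎
  where open ≤-Reasoning

module Iteration {n} (G : Graph n) (W : DiamLe2 G) (r : Fin n) where
  open Gains G r

  hub-exists : ∀ (C : Config n) → ∃[ M ] (∀ {v} → v ≢ r → 3 ≤ C v → M ≢ r × 3 ≤ C M)
  hub-exists C with any? (λ v → ¬? (v ≟ r) ×-dec (3 ≤? C v))
  ... | yes (M , M≢r , 3≤CM) = M , λ _ _ → M≢r , 3≤CM
  ... | no none              = r , λ v≢r 3≤Cv → ⊥-elim (none (_ , v≢r , 3≤Cv))

  gain-from-surplus : ∀ C → C r + n < size C → Gain 6 C
  gain-from-surplus C c+n<size with Claims.bounded-or-gain G W r C _ (proj₂ (hub-exists C))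
  ... | inj₁ bounded = ⊥-elim (<⇒≱ c+n<size bounded)
  ... | inj₂ g       = g

  solvable : ∀ k d C → k ≤ d + C r → n + 7 * k ≤ size C + 6 * C r + 6 → Solvable G k r C
  solvable k zero    C enough _ = C , ε , enough
  solvable k (suc d) C enough budget with k ≤? C r
  ... | yes done = C , ε , done
  ... | no short with gain-from-surplus C (surplus n (≰⇒> short) budget)
  ...   | gain D moves grows cost =
    let E , moves′ , solved = solvable k d D enough′ budget′ in E , moves ◅◅ moves′ , solved
    where
    enough′ : k ≤ d + D r
    enough′ = ≤-trans enough (≤-trans (≤-reflexive (sym (+-suc d (C r)))) (+-monoʳ-≤ d grows))
    budget′ : n + 7 * k ≤ size D + 6 * D r + 6
    budget′ = ≤-trans budget (+-monoˡ-≤ 6 (potential-mono grows cost))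

theorem3 : ∀ (n : ℕ) (G : Graph n) → Connected G → DiamLe2 G →
    ∀ (k : ℕ) → 1 ≤ k → PiGraphLe G k (n + 7 * k ∸ 6)
theorem3 n G _ W k 1≤k r = n + 7 * k ∸ 6 , 1≤m , ≤-refl , λ C size≡m →
  Iteration.solvable G W r k k C (m≤m+n k (C r)) (budget C size≡m)
  where
  7≤ : 7 ≤ n + 7 * k
  7≤ = ≤-trans (*-monoʳ-≤ 7 1≤k) (m≤n+m (7 * k) n)
  1≤m : 1 ≤ n + 7 * k ∸ 6
  1≤m = ∸-monoˡ-≤ 6 7≤
  budget : ∀ C → size C ≡ n + 7 * k ∸ 6 → n + 7 * k ≤ size C + 6 * C r + 6
  budget C size≡m = begin
    n + 7 * k              ≡⟨ sym (m∸n+n≡m (≤-trans (n≤1+n 6) 7≤)) ⟩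
    n + 7 * k ∸ 6 + 6      ≡⟨ cong (_+ 6) (sym size≡m) ⟩
    size C + 6             ≤⟨ +-monoˡ-≤ 6 (m≤m+n (size C) (6 * C r)) ⟩
    size C + 6 * C r + 6   ∎
    where open ≤-Reasoning
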